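{- Let $f_1,\dots,f_n,g_1,\dots,g_n\in\mathbb{F}_p[x]$ be polynomials in a tuple of variables $x=(x_1,\dots,x_m)$. Then $$\mathbb{F}_p[t^{1/p^{\infty}}]/(t)\models\exists x\bigwedge_{1\le i,j\le n}\big(f_i(x)=0\wedge g_j(x)\ne0\big)$$ if and only if $$\mathbb{F}_p[[t]]^{1/p^{\infty}}\models\exists x\bigwedge_{1\le i,j\le n}\big(v(f_i(x))>v(g_j(x))\big).$$
   Context: $\mathbb{F}_p[t^{1/p^{\infty}}]=\bigcup_n\mathbb{F}_p[t^{1/p^n}]$ and $\mathbb{F}_p[[t]]^{1/p^{\infty}}=\bigcup_n\mathbb{F}_p[[t^{1/p^n}]]$ is the perfect hull of $\mathbb{F}_p[[t]]$, with $v$ the ($\frac{1}{p^\infty}\mathbb{Z}$-valued) extension of the $t$-adic valuation. Existential quantifiers range over tuples of elements of the respective rings. -}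

module Defs where

open import Data.Nat using (ℕ; zero; suc; _+_; _*_; _∸_; _^_; _≤_; _<_)
open import Data.Nat.Divisibility using (_∣_)
open import Data.Fin using (Fin)
open import Data.Product using (Σ; ∃; ∃-syntax; _×_)
open import Relation.Nullary using (¬_)

-- A constant c : ℕ stands for its residue class c mod p in F_p; every
-- element of F_p[x_1..x_m] is denoted by some such expression, and
-- evaluation below is the (unique) ring-homomorphic evaluation.
data Poly (m : ℕ) : Set where
  con  : ℕ → Poly m
  var  : Fin m → Poly m
  _⊕_  : Poly m → Poly m → Poly m
  _⊗_  : Poly m → Poly m → Poly m

-- Power series in s = t^{1/p^N} (for some fixed N), coefficient k being the
-- coefficient of s^k.  Coefficients are natural numbers read modulo p
-- (ℕ → F_p is a ring map, and all operations below are ring operations,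
-- so reducing mod p at the end is the same as computing in F_p).
Ser : Set
Ser = ℕ → ℕ

sumTo : (ℕ → ℕ) → ℕ → ℕ
sumTo f zero    = 0
sumTo f (suc n) = sumTo f n + f n

conS : ℕ → Ser
conS c zero    = c
conS c (suc k) = 0

addS : Ser → Ser → Ser
addS a b k = a k + b k

mulS : Ser → Ser → Ser
mulS a b k = sumTo (λ i → a i * b (k ∸ i)) (suc k)

eval : ∀ {m} → Poly m → (Fin m → Ser) → Ser
eval (con c) x = conS c
eval (var i) x = x i
eval (f ⊕ g) x = addS (eval f x) (eval g x)
eval (f ⊗ g) x = mulS (eval f x) (eval g x)

Zp : ℕ → ℕ → Set
Zp p c = p ∣ c

IsPolyS : ℕ → Ser → Set
IsPolyS p a = Σ ℕ λ B → (∀ k → B ≤ k → Zp p (a k))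

-- membership in the ideal (t) of F_p[t^{1/p^N}] ⊆ F_p[t^{1/p^∞}], t = s^{p^N}:
-- all coefficients of s^k with k < p^N vanish.
InIdealT : ℕ → ℕ → Ser → Set
InIdealT p N a = ∀ k → k < p ^ N → Zp p (a k)

-- v(a) > v(b) for a, b ∈ F_p[[s]], s = t^{1/p^N}, with v(0) = ∞:
-- b ≠ 0 with some nonzero coefficient at s^k, and a has no nonzero
-- coefficient at s^i for i ≤ k (so ord(a) > ord(b), v = ord / p^N).
VGt : ℕ → Ser → Ser → Set
VGt p a b = Σ ℕ λ k → (¬ Zp p (b k) × (∀ i → i ≤ k → Zp p (a i)))

-- F_p[t^{1/p^∞}]/(t) ⊨ ∃x ⋀_{i,j} (f_i(x) = 0 ∧ g_j(x) ≠ 0).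
-- A tuple of elements of F_p[t^{1/p^∞}] = ⋃_N F_p[t^{1/p^N}] lies in a
-- common F_p[t^{1/p^N}].
SatQuot : ℕ → (m n : ℕ) → (f g : Fin n → Poly m) → Set
SatQuot p m n f g =
  Σ ℕ λ N → Σ (Fin m → Ser) λ x →
    (∀ l → IsPolyS p (x l)) ×
    (∀ i j → InIdealT p N (eval (f i) x) × ¬ InIdealT p N (eval (g j) x))

-- F_p[[t]]^{1/p^∞} ⊨ ∃x ⋀_{i,j} v(f_i(x)) > v(g_j(x)).
-- A tuple of elements of ⋃_N F_p[[t^{1/p^N}]] lies in a common F_p[[t^{1/p^N}]].
SatVal : ℕ → (m n : ℕ) → (f g : Fin n → Poly m) → Set
SatVal p m n f g =
  Σ ℕ λ N → Σ (Fin m → Ser) λ x →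
    (∀ i j → VGt p (eval (f i) x) (eval (g j) x))

-- If v(f i (x)) > v(g j (x)) for all i, j, then with B the largest order of the g j (x),
-- every f i (x) vanishes up to order B while every g j (x) has a nonzero coefficient of
-- order ≤ B.  Truncating x above degree B keeps these coefficients and makes x polynomial,
-- and the substitution s ↦ s^c with c B < p^N ≤ c (B + 1) moves them to orders ≤ c B < p^N,
-- while the coefficients of the f i (x) below p^N become zero: that is f i ∈ (t) and
-- g j ∉ (t) in F_p[t^{1/p^N}].  Conversely, the first nonzero coefficient of g j (x) below
-- p^N witnesses v(f i) > v(g j).

module Submission where

open import Defs
open import Data.Nat using (ℕ; zero; suc; _+_; _*_; _∸_; _^_; _≤_; _<_; z≤n; s≤s; NonZero; >-nonZero; _<?_)
open import Data.Nat.Properties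
open import Data.Nat.Divisibility
  using (_∣_; divides; _∣?_; _∣0; ∣m+n∣m⇒∣n; ∣m∣n⇒∣m+n; ∣⇒≤; n∣m*n)
open import Data.Nat.DivMod using (_/_; _%_; m≡m%n+[m/n]*n; m%n≤n; m/n*n≤m; m*n/n≡m; /-monoˡ-≤)
open import Data.Nat.Induction using (<-rec)
open import Data.Nat.Primality using (Prime; prime⇒nonTrivial)
open import Data.Nat.Base using (nonTrivial⇒n>1)
open import Data.Fin using (Fin; zero; suc)
open import Data.List using (allFin)
open import Data.List.Extrema.Nat using (argmax; f[xs]≤f[argmax])
open import Data.List.Membership.Propositional.Properties using (∈-allFin)
import Data.List.Relation.Unary.All as All
open import Data.Product using (∃-syntax; _×_; _,_; proj₁; proj₂)
open import Relation.Nullary using (¬_; yes; no; contradiction)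
open import Relation.Nullary.Decidable using (¬?; decidable-stable)
open import Relation.Unary using (Pred; Decidable)
open import Relation.Binary.PropositionalEquality
open import Function.Bundles using (_⇔_; mk⇔)

sumTo-cong : ∀ {h h′ : ℕ → ℕ} n → (∀ i → i < n → h i ≡ h′ i) → sumTo h n ≡ sumTo h′ n
sumTo-cong zero    _ = refl
sumTo-cong (suc n) e = cong₂ _+_ (sumTo-cong n (λ i i<n → e i (m<n⇒m<1+n i<n))) (e n ≤-refl)

sumTo-≡0 : ∀ {h : ℕ → ℕ} n → (∀ i → i < n → h i ≡ 0) → sumTo h n ≡ 0
sumTo-≡0 zero    _ = refl
sumTo-≡0 (suc n) e = cong₂ _+_ (sumTo-≡0 n (λ i i<n → e i (m<n⇒m<1+n i<n))) (e n ≤-refl)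

sumTo-+ : ∀ h a d → sumTo h (a + d) ≡ sumTo h a + sumTo (λ j → h (a + j)) d
sumTo-+ h a zero    = trans (cong (sumTo h) (+-identityʳ a)) (sym (+-identityʳ _))
sumTo-+ h a (suc d) rewrite +-suc a d | sumTo-+ h a d =
  +-assoc (sumTo h a) (sumTo (λ j → h (a + j)) d) (h (a + d))

eval-cong-below : ∀ {m} (f : Poly m) {x y : Fin m → Ser} T →
                  (∀ l k → k < T → x l k ≡ y l k) → ∀ k → k < T → eval f x k ≡ eval f y k
eval-cong-below (con c) T e k k<T = refl
eval-cong-below (var l) T e k k<T = e l k k<T
eval-cong-below (f ⊕ g) T e k k<T =
  cong₂ _+_ (eval-cong-below f T e k k<T) (eval-cong-below g T e k k<T)
eval-cong-below (f ⊗ g) T e k k<T = sumTo-cong (suc k) λ i i<1+k →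
  cong₂ _*_ (eval-cong-below f T e i (≤-<-trans (≤-pred i<1+k) k<T))
            (eval-cong-below g T e (k ∸ i) (≤-<-trans (m∸n≤m k i) k<T))

-- b(s) = a(s^c)
Dilated : ℕ → Ser → Ser → Set
Dilated c a b = (∀ u → b (u * c) ≡ a u) × (∀ k → ¬ c ∣ k → b k ≡ 0)

Zp-dilated : ∀ {p c a b} → Dilated c a b →
             ∀ k → (∀ u → k ≡ u * c → Zp p (a u)) → Zp p (b k)
Zp-dilated {p} {c} {a} {b} (b∘c≡a , b≡0) k Zp[a] with c ∣? k
... | yes (divides u k≡uc) = subst (Zp p) (sym (trans (cong b k≡uc) (b∘c≡a u))) (Zp[a] u k≡uc)
... | no  c∤k              = subst (Zp p) (sym (b≡0 k c∤k)) (p ∣0)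

∤[multiple+r] : ∀ c .{{_ : NonZero c}} u {r} → 0 < r → r < c → ¬ c ∣ u * c + r
∤[multiple+r] c u 0<r r<c c∣uc+r =
  <⇒≱ r<c (∣⇒≤ {{>-nonZero 0<r}} (∣m+n∣m⇒∣n c∣uc+r (n∣m*n u)))

sumTo-multiples : ∀ c .{{_ : NonZero c}} (h : ℕ → ℕ) → (∀ i → ¬ c ∣ i → h i ≡ 0) →
                  ∀ u → sumTo h (suc (u * c)) ≡ sumTo (λ w → h (w * c)) (suc u)
sumTo-multiples c       h h≡0 zero    = refl
sumTo-multiples (suc d) h h≡0 (suc u) = begin
    sumTo h (suc (suc d + M))
  ≡⟨ cong (λ z → sumTo h (suc z)) (+-comm (suc d) M) ⟩
    sumTo h (suc M + suc d)
  ≡⟨ sumTo-+ h (suc M) (suc d) ⟩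
    sumTo h (suc M) + (sumTo (λ j → h (suc M + j)) d + h (suc M + d))
  ≡⟨ cong₂ (λ a b → sumTo h (suc M) + (a + b))
       (sumTo-≡0 d (λ j j<d → h≡0 _ (between j j<d)))
       (cong (λ z → h (suc z)) (+-comm M d)) ⟩
    sumTo h (suc M) + h (suc d + M)
  ≡⟨ cong (_+ h (suc d + M)) (sumTo-multiples (suc d) h h≡0 u) ⟩
    sumTo (λ w → h (w * suc d)) (suc u) + h (suc d + M)
  ∎
  where
  open ≡-Reasoning
  M = u * suc d
  between : ∀ j → j < d → ¬ suc d ∣ suc (M + j)
  between j j<d rewrite sym (+-suc M j) = ∤[multiple+r] (suc d) u (s≤s z≤n) (s≤s j<d)

conS-dilated : ∀ c .{{_ : NonZero c}} a → Dilated c (conS a) (conS a)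
conS-dilated c@(suc _) a = conS∘c , conS-off
  where
  conS∘c : ∀ u → conS a (u * c) ≡ conS a u
  conS∘c zero    = refl
  conS∘c (suc u) = refl
  conS-off : ∀ k → ¬ c ∣ k → conS a k ≡ 0
  conS-off zero    c∤0 = contradiction (c ∣0) c∤0
  conS-off (suc k) _   = refl

addS-dilated : ∀ {c a b a′ b′} → Dilated c a a′ → Dilated c b b′ →
               Dilated c (addS a b) (addS a′ b′)
addS-dilated (a∘c , a≡0) (b∘c , b≡0) =
  (λ u → cong₂ _+_ (a∘c u) (b∘c u)) , (λ k c∤k → cong₂ _+_ (a≡0 k c∤k) (b≡0 k c∤k))

mulS-dilated : ∀ c .{{_ : NonZero c}} {a b a′ b′} → Dilated c a a′ → Dilated c b b′ →
               Dilated c (mulS a b) (mulS a′ b′)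
mulS-dilated c {a} {b} {a′} {b′} (a∘c , a≡0) (b∘c , b≡0) = mul∘c , mul-off
  where
  open ≡-Reasoning
  mul∘c : ∀ u → mulS a′ b′ (u * c) ≡ mulS a b u
  mul∘c u = begin
      sumTo (λ i → a′ i * b′ (u * c ∸ i)) (suc (u * c))
    ≡⟨ sumTo-multiples c _ (λ i c∤i → cong (_* b′ (u * c ∸ i)) (a≡0 i c∤i)) u ⟩
      sumTo (λ w → a′ (w * c) * b′ (u * c ∸ w * c)) (suc u)
    ≡⟨ sumTo-cong (suc u) (λ w _ → cong₂ _*_ (a∘c w)
         (trans (cong b′ (sym (*-distribʳ-∸ c u w))) (b∘c (u ∸ w)))) ⟩
      sumTo (λ w → a w * b (u ∸ w)) (suc u)
    ∎
  -- if c ∤ k then c ∤ i or c ∤ k ∸ i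
  term≡0 : ∀ {k} → ¬ c ∣ k → ∀ i → i ≤ k → a′ i * b′ (k ∸ i) ≡ 0
  term≡0 {k} c∤k i i≤k with c ∣? i
  ... | no  c∤i rewrite a≡0 i c∤i = refl
  ... | yes c∣i = trans (cong (a′ i *_) (b≡0 (k ∸ i) c∤k∸i)) (*-zeroʳ (a′ i))
    where
    c∤k∸i : ¬ c ∣ k ∸ i
    c∤k∸i c∣k∸i = c∤k (subst (c ∣_) (m+[n∸m]≡n i≤k) (∣m∣n⇒∣m+n c∣i c∣k∸i))
  mul-off : ∀ k → ¬ c ∣ k → mulS a′ b′ k ≡ 0
  mul-off k c∤k = sumTo-≡0 (suc k) λ i i<1+k → term≡0 c∤k i (≤-pred i<1+k)

eval-dilated : ∀ c .{{_ : NonZero c}} {m} (f : Poly m) {x y : Fin m → Ser} →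
               (∀ l → Dilated c (x l) (y l)) → Dilated c (eval f x) (eval f y)
eval-dilated c (con a) D = conS-dilated c a
eval-dilated c (var l) D = D l
eval-dilated c (f ⊕ g) D = addS-dilated (eval-dilated c f D) (eval-dilated c g D)
eval-dilated c (f ⊗ g) D = mulS-dilated c (eval-dilated c f D) (eval-dilated c g D)

dilate : ℕ → Ser → Ser
dilate c a k with c ∣? k
... | yes (divides u _) = a u
... | no  _             = 0

dilate-dilated : ∀ c .{{_ : NonZero c}} a → Dilated c a (dilate c a)
dilate-dilated c a = dilate∘c , dilate-off
  where
  dilate∘c : ∀ u → dilate c a (u * c) ≡ a u
  dilate∘c u with c ∣? u * c
  ... | yes (divides v uc≡vc) = cong a (sym (*-cancelʳ-≡ u v c uc≡vc))
  ... | no  c∤uc              = contradiction (n∣m*n u) c∤uc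
  dilate-off : ∀ k → ¬ c ∣ k → dilate c a k ≡ 0
  dilate-off k c∤k with c ∣? k
  ... | yes c∣k = contradiction c∣k c∤k
  ... | no  _   = refl

truncate : ℕ → Ser → Ser
truncate T a k with k <? T
... | yes _ = a k
... | no  _ = 0

truncate-< : ∀ T a k → k < T → truncate T a k ≡ a k
truncate-< T a k k<T with k <? T
... | yes _   = refl
... | no  k≮T = contradiction k<T k≮T

truncate-≥ : ∀ T a k → T ≤ k → truncate T a k ≡ 0
truncate-≥ T a k T≤k with k <? T
... | yes k<T = contradiction T≤k (<⇒≱ k<T)
... | no  _   = refl

least-witness : ∀ {ℓ} {P : Pred ℕ ℓ} → Decidable P →
                ∀ {k} → P k → ∃[ e ] P e × (∀ i → P i → e ≤ i)
least-witness {P = P} P? {k} = <-rec (λ k → P k → ∃[ e ] P e × (∀ i → P i → e ≤ i)) step k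
  where
  step : ∀ k → (∀ {i} → i < k → P i → ∃[ e ] P e × (∀ i → P i → e ≤ i)) →
         P k → ∃[ e ] P e × (∀ i → P i → e ≤ i)
  step k below pk with anyUpTo? P? k
  ... | yes (i , i<k , pi) = below i<k pi
  ... | no  none           = k , pk , λ i pi → ≮⇒≥ (λ i<k → none (i , i<k , pi))

n<m^n : ∀ {m} → 1 < m → ∀ n → n < m ^ n
n<m^n 1<m zero    = s≤s z≤n
n<m^n {m} 1<m (suc n) = ≤-<-trans (n<m^n 1<m n) (^-monoʳ-< m 1<m (n<1+n n))

-- c = ⌊P / (B+1)⌋ + 1; the lower bound needs ⌊P / (B+1)⌋ > B, hence P ≥ (B+1)².
dilation-factor : ∀ B P → suc B * suc B ≤ P → ∃[ d ] B * suc d < P × P ≤ suc d * suc B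
dilation-factor B P D²≤P = q , B*c<P , P≤c*D
  where
  open ≤-Reasoning
  D = suc B
  q = P / D
  D≤q : D ≤ q
  D≤q = subst (_≤ q) (m*n/n≡m D D) (/-monoˡ-≤ D D²≤P)
  B*c<P : B * suc q < P
  B*c<P = begin-strict
      B * suc q  ≡⟨ *-suc B q ⟩
      B + B * q  <⟨ +-monoˡ-< (B * q) D≤q ⟩
      D * q      ≡⟨ *-comm D q ⟩
      q * D      ≤⟨ m/n*n≤m P D ⟩
      P          ∎
  P≤c*D : P ≤ suc q * D
  P≤c*D = begin
      P              ≡⟨ m≡m%n+[m/n]*n P D ⟩
      P % D + q * D  ≤⟨ +-monoˡ-≤ (q * D) (m%n≤n P D) ⟩
      suc q * D      ∎

InIdealT×¬InIdealT⇒VGt : ∀ p N {a b} → InIdealT p N a → ¬ InIdealT p N b → VGt p a b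
InIdealT×¬InIdealT⇒VGt p N {a} {b} a∈⟨t⟩ b∉⟨t⟩ with anyUpTo? (λ k → ¬? (p ∣? b k)) (p ^ N)
... | yes (k , k<P , b[k]≢0) = k , b[k]≢0 , λ i i≤k → a∈⟨t⟩ i (≤-<-trans i≤k k<P)
... | no  none               = contradiction b∈⟨t⟩ b∉⟨t⟩
  where
  b∈⟨t⟩ : InIdealT p N b
  b∈⟨t⟩ k k<P = decidable-stable (p ∣? b k) (λ b[k]≢0 → none (k , k<P , b[k]≢0))

satQuot⇒satVal : ∀ p m n (f g : Fin n → Poly m) → SatQuot p m n f g → SatVal p m n f g
satQuot⇒satVal p m n f g (N , x , _ , sep) =
  N , x , λ i j → InIdealT×¬InIdealT⇒VGt p N (proj₁ (sep i j)) (proj₂ (sep i j))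

SeparatedAt : ℕ → ∀ {m n} → (f g : Fin n → Poly m) → (Fin m → Ser) → ℕ → Set
SeparatedAt p f g x B =
  (∀ i k → k ≤ B → Zp p (eval (f i) x k)) × (∀ j → ∃[ e ] e ≤ B × ¬ Zp p (eval (g j) x e))

VGt⇒separatedAt : ∀ p {m} n (f g : Fin n → Poly m) x →
                  (∀ i j → VGt p (eval (f i) x) (eval (g j) x)) → ∃[ B ] SeparatedAt p f g x B
VGt⇒separatedAt p zero    f g x _ = 0 , (λ ()) , (λ ())
VGt⇒separatedAt p (suc n) f g x V = ord j* , f-vanishes , g-nonzero
  where
  least-nonzero : ∀ j → ∃[ e ] ¬ Zp p (eval (g j) x e) × (∀ k → ¬ Zp p (eval (g j) x k) → e ≤ k)
  least-nonzero j = least-witness (λ k → ¬? (p ∣? eval (g j) x k)) (proj₁ (proj₂ (V j j)))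
  ord : Fin (suc n) → ℕ
  ord j = proj₁ (least-nonzero j)
  j* : Fin (suc n)
  j* = argmax ord zero (allFin (suc n))
  ord≤ord[j*] : ∀ j → ord j ≤ ord j*
  ord≤ord[j*] j = All.lookup (f[xs]≤f[argmax] {f = ord} zero (allFin (suc n))) (∈-allFin j)
  f-vanishes : ∀ i k → k ≤ ord j* → Zp p (eval (f i) x k)
  f-vanishes i k k≤ord =
    let k′ , g[k′]≢0 , f-vanishes-to-k′ = V i j*
    in f-vanishes-to-k′ k (≤-trans k≤ord (proj₂ (proj₂ (least-nonzero j*)) k′ g[k′]≢0))
  g-nonzero : ∀ j → ∃[ e ] e ≤ ord j* × ¬ Zp p (eval (g j) x e)
  g-nonzero j = ord j , ord≤ord[j*] j , proj₁ (proj₂ (least-nonzero j))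

separatedAt⇒satQuot : ∀ p → 1 < p → ∀ {m n} (f g : Fin n → Poly m) x B →
                      SeparatedAt p f g x B → SatQuot p m n f g
separatedAt⇒satQuot p 1<p {m} f g x B (f-vanishes , g-nonzero) =
  N , y , y-poly , λ i j → f∈⟨t⟩ i , g∉⟨t⟩ j
  where
  N = suc B * suc B
  factor = dilation-factor B (p ^ N) (<⇒≤ (n<m^n 1<p N))
  c = suc (proj₁ factor)
  B*c<p^N = proj₁ (proj₂ factor)
  p^N≤c*T = proj₂ (proj₂ factor)
  T = suc B
  x′ : Fin m → Ser
  x′ l = truncate T (x l)
  y : Fin m → Ser
  y l = dilate c (x′ l)
  y-dilated : ∀ (h : Poly m) → Dilated c (eval h x′) (eval h y)
  y-dilated h = eval-dilated c h (λ l → dilate-dilated c (x′ l))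
  x′-agrees : ∀ (h : Poly m) u → u < T → eval h x′ u ≡ eval h x u
  x′-agrees h = eval-cong-below h T (λ l → truncate-< T (x l))
  y-poly : ∀ l → IsPolyS p (y l)
  y-poly l = T * c , λ k T*c≤k → Zp-dilated (dilate-dilated c (x′ l)) k λ where
    u refl → subst (Zp p) (sym (truncate-≥ T (x l) u (*-cancelʳ-≤ T u c T*c≤k))) (p ∣0)
  f∈⟨t⟩ : ∀ i → InIdealT p N (eval (f i) y)
  f∈⟨t⟩ i k k<p^N = Zp-dilated (y-dilated (f i)) k λ where
    u refl → let u<T = *-cancelʳ-< c u T (<-≤-trans k<p^N (≤-trans p^N≤c*T (≤-reflexive (*-comm c T))))
             in subst (Zp p) (sym (x′-agrees (f i) u u<T)) (f-vanishes i u (≤-pred u<T))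
  g∉⟨t⟩ : ∀ j → ¬ InIdealT p N (eval (g j) y)
  g∉⟨t⟩ j g∈⟨t⟩ with g-nonzero j
  ... | e , e≤B , g[e]≢0 = g[e]≢0 (subst (Zp p) y[e*c]≡x[e] (g∈⟨t⟩ (e * c) e*c<p^N))
    where
    y[e*c]≡x[e] : eval (g j) y (e * c) ≡ eval (g j) x e
    y[e*c]≡x[e] = trans (proj₁ (y-dilated (g j)) e) (x′-agrees (g j) e (s≤s e≤B))
    e*c<p^N : e * c < p ^ N
    e*c<p^N = ≤-<-trans (*-monoˡ-≤ c e≤B) B*c<p^N

mainTheorem11 : (p : ℕ) → Prime p → (m n : ℕ) → (f g : Fin n → Poly m) →
    SatQuot p m n f g ⇔ SatVal p m n f g
mainTheorem11 p p-prime m n f g = mk⇔ (satQuot⇒satVal p m n f g) satVal⇒satQuot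
  where
  1<p : 1 < p
  1<p = nonTrivial⇒n>1 p {{prime⇒nonTrivial p-prime}}
  satVal⇒satQuot : SatVal p m n f g → SatQuot p m n f g
  satVal⇒satQuot (_ , x , V) with VGt⇒separatedAt p n f g x V
  ... | B , separated = separatedAt⇒satQuot p 1<p f g x B separated
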